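{- Let $m\ge 1$, let $W\subseteq\{0,1\}^m$ be a set of binary strings each of which has exactly two bits equal to $1$, and let $x\in\{0,1\}^m$ be a string with exactly two bits equal to $1$, say at positions $i\neq j$, with $x\notin W$. For a position $l$, let $N_l=\{y\in W : \text{the } l\text{ -th bit of } y \text{ is } 1\}$. Then $x$ is expressible from $W$ if and only if $|N_i|\ge 2$ and $|N_j|\ge 2$.
   Context: For binary strings $s_1,s_2\in\{0,1\}^m$, $s_1\wedge s_2$ and $s_1\vee s_2$ denote bitwise AND and bitwise OR. A string $s$ is expressible (representable) from a set $W$ of strings if there is a formula with operators in $\{\wedge,\vee\}$ whose operands are taken from some subset of $W$ and which evaluates to $s$. -}

module Defs where

open import Data.Nat using (ℕ; suc)
open import Data.Bool using (Bool; true; false; _∧_; _∨_)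
open import Data.Vec using (Vec; zipWith; lookup; count)
open import Data.Fin using (Fin)
open import Data.List using (List; length; filter)
open import Data.Product using (Σ)
open import Data.List.Membership.Propositional using (_∈_)
open import Data.Bool.Properties using (_≟_)
open import Relation.Nullary using (does)
open import Relation.Binary.PropositionalEquality using (_≡_)
open import Relation.Unary using (Pred)
open import Relation.Nullary.Decidable using (Dec)

BitString : ℕ → Set
BitString m = Vec Bool m

_⋀_ : ∀ {m} → BitString m → BitString m → BitString m
_⋀_ = zipWith _∧_

_⋁_ : ∀ {m} → BitString m → BitString m → BitString m
_⋁_ = zipWith _∨_

weight : ∀ {m} → BitString m → ℕ
weight s = count (λ b → b ≟ true) s

data Formula {m : ℕ} (W : List (BitString m)) : Set where
  var  : (w : BitString m) → w ∈ W → Formula W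
  and  : Formula W → Formula W → Formula W
  or   : Formula W → Formula W → Formula W

eval : ∀ {m} {W : List (BitString m)} → Formula W → BitString m
eval (var w _) = w
eval (and f g) = eval f ⋀ eval g
eval (or f g)  = eval f ⋁ eval g

Expressible : ∀ {m} → List (BitString m) → BitString m → Set
Expressible W s = Σ (Formula W) (λ f → eval f ≡ s)

N : ∀ {m} → List (BitString m) → Fin m → List (BitString m)
N W l = filter (λ y → lookup y l ≟ true) W

module Submission where

-- Write s ⊑ t for bitwise inclusion; s ⊑ t together with weight t ≤ weight s forces s = t.
-- The meet of two distinct strings of weight 2 sharing bit k is exactly bit k, so if
-- |N_i|, |N_j| ≥ 2 then x = (a ∧ b) ∨ (c ∧ d) for distinct a, b ∈ N_i and c, d ∈ N_j.
-- Conversely, the properties "bit i is clear" and "bit i set ⇒ a ⊑ s" are closed under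
-- ∧ and ∨. So if N_i is empty no expressible string has bit i, and if N_i = {a} every
-- expressible string with bit i lies above a; for x that gives x = a ∈ W.

open import Defs
open import Level using (Level)
open import Data.Nat using (ℕ; _≤_; _≥_; z≤n; s≤s)
open import Data.Nat.Properties using (≤-reflexive; ≤-trans; m≤n⇒m≤1+n; 1+n≰n)
open import Data.Bool using (true; false; _∧_; _∨_)
open import Data.Bool.Properties using (_≟_)
open import Data.Fin using (Fin; zero; suc)
import Data.Fin.Properties as Fin
open import Data.List using (List; []; _∷_; length)
open import Data.List.Relation.Unary.All as All using (All; []; _∷_)
open import Data.List.Relation.Unary.AllPairs using (_∷_)
open import Data.List.Relation.Unary.Any using (here; there)
open import Data.List.Relation.Unary.Unique.Propositional using (Unique)
open import Data.List.Relation.Unary.Unique.Propositional.Properties using (filter⁺)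
open import Data.List.Membership.Propositional using (_∈_; _∉_)
open import Data.List.Membership.Propositional.Properties using (∈-filter⁺; ∈-filter⁻)
open import Data.Vec using (_∷_; []; lookup)
open import Data.Vec.Properties using (lookup-zipWith)
open import Data.Product using (Σ; ∃₂; _×_; _,_; proj₁; proj₂)
open import Data.Sum using (_⊎_; inj₁; inj₂; [_,_])
open import Data.Empty using (⊥-elim)
open import Function using (_∘_)
open import Function.Bundles using (_⇔_; mk⇔)
open import Relation.Nullary using (yes; no)
open import Relation.Unary using (Pred)
open import Relation.Binary.PropositionalEquality
  using (_≡_; _≢_; refl; sym; trans; cong; cong₂; subst)

private
  variable
    m : ℕ
    ℓ : Level

infix 4 _⊑_

record _⊑_ (s t : BitString m) : Set where
  constructor mk⊑
  field lookup-⊑ : ∀ p → lookup s p ≡ true → lookup t p ≡ true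

open _⊑_

∧-true⁻ : ∀ {a b} → a ∧ b ≡ true → a ≡ true × b ≡ true
∧-true⁻ {true} {true} refl = refl , refl

∨-true⁻ : ∀ {a b} → a ∨ b ≡ true → a ≡ true ⊎ b ≡ true
∨-true⁻ {true}  _    = inj₁ refl
∨-true⁻ {false} b≡t = inj₂ b≡t

∨-trueˡ : ∀ {a} b → a ≡ true → a ∨ b ≡ true
∨-trueˡ _ refl = refl

∨-trueʳ : ∀ a {b} → b ≡ true → a ∨ b ≡ true
∨-trueʳ true  _    = refl
∨-trueʳ false b≡t = b≡t

lookup-⋀ : (s t : BitString m) (p : Fin m) → lookup (s ⋀ t) p ≡ lookup s p ∧ lookup t p
lookup-⋀ s t p = lookup-zipWith _∧_ p s t

lookup-⋁ : (s t : BitString m) (p : Fin m) → lookup (s ⋁ t) p ≡ lookup s p ∨ lookup t p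
lookup-⋁ s t p = lookup-zipWith _∨_ p s t

⊑-trans : {s t u : BitString m} → s ⊑ t → t ⊑ u → s ⊑ u
⊑-trans s⊑t t⊑u = mk⊑ λ p → lookup-⊑ t⊑u p ∘ lookup-⊑ s⊑t p

⋀-⊑ˡ : (s t : BitString m) → s ⋀ t ⊑ s
⋀-⊑ˡ s t = mk⊑ λ p h → proj₁ (∧-true⁻ (trans (sym (lookup-⋀ s t p)) h))

⋀-⊑ʳ : (s t : BitString m) → s ⋀ t ⊑ t
⋀-⊑ʳ s t = mk⊑ λ p h → proj₂ (∧-true⁻ (trans (sym (lookup-⋀ s t p)) h))

⋀-true : (s t : BitString m) {p : Fin m} → lookup s p ≡ true → lookup t p ≡ true →
         lookup (s ⋀ t) p ≡ true
⋀-true s t {p} sp tp = trans (lookup-⋀ s t p) (cong₂ _∧_ sp tp)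

⋀-greatest : {u : BitString m} (s t : BitString m) → u ⊑ s → u ⊑ t → u ⊑ s ⋀ t
⋀-greatest s t u⊑s u⊑t = mk⊑ λ p h → ⋀-true s t (lookup-⊑ u⊑s p h) (lookup-⊑ u⊑t p h)

⋁-⊑ˡ : (s t : BitString m) → s ⊑ s ⋁ t
⋁-⊑ˡ s t = mk⊑ λ p h → trans (lookup-⋁ s t p) (∨-trueˡ (lookup t p) h)

⋁-⊑ʳ : (s t : BitString m) → t ⊑ s ⋁ t
⋁-⊑ʳ s t = mk⊑ λ p h → trans (lookup-⋁ s t p) (∨-trueʳ (lookup s p) h)

⋁-true⁻ : (s t : BitString m) {p : Fin m} → lookup (s ⋁ t) p ≡ true →
          lookup s p ≡ true ⊎ lookup t p ≡ true
⋁-true⁻ s t {p} h = ∨-true⁻ (trans (sym (lookup-⋁ s t p)) h)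

⋁-least : {u : BitString m} (s t : BitString m) → s ⊑ u → t ⊑ u → s ⋁ t ⊑ u
⋁-least s t s⊑u t⊑u = mk⊑ λ p h → [ lookup-⊑ s⊑u p , lookup-⊑ t⊑u p ] (⋁-true⁻ s t h)

⊑-tail : ∀ {x y} {s t : BitString m} → x ∷ s ⊑ y ∷ t → s ⊑ t
⊑-tail h = mk⊑ (lookup-⊑ h ∘ suc)

weight-mono : {s t : BitString m} → s ⊑ t → weight s ≤ weight t
weight-mono {s = []}        {[]}        _ = z≤n
weight-mono {s = true ∷ s}  {false ∷ t} h with lookup-⊑ h zero refl
... | ()
weight-mono {s = true ∷ s}  {true ∷ t}  h = s≤s (weight-mono (⊑-tail h))
weight-mono {s = false ∷ s} {true ∷ t}  h = m≤n⇒m≤1+n (weight-mono (⊑-tail h))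
weight-mono {s = false ∷ s} {false ∷ t} h = weight-mono (⊑-tail h)

⊑-antisym-weight : {s t : BitString m} → s ⊑ t → weight t ≤ weight s → s ≡ t
⊑-antisym-weight {s = []}        {[]}        _ _ = refl
⊑-antisym-weight {s = true ∷ s}  {false ∷ t} h _ with lookup-⊑ h zero refl
... | ()
⊑-antisym-weight {s = true ∷ s}  {true ∷ t}  h (s≤s w) =
  cong (true ∷_) (⊑-antisym-weight (⊑-tail h) w)
⊑-antisym-weight {s = false ∷ s} {false ∷ t} h w =
  cong (false ∷_) (⊑-antisym-weight (⊑-tail h) w)
⊑-antisym-weight {s = false ∷ s} {true ∷ t}  h w =
  ⊥-elim (1+n≰n (≤-trans w (weight-mono (⊑-tail h))))

weight≥1 : (s : BitString m) (p : Fin m) → lookup s p ≡ true → 1 ≤ weight s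
weight≥1 (true ∷ s)  zero    _ = s≤s z≤n
weight≥1 (true ∷ s)  (suc p) _ = s≤s z≤n
weight≥1 (false ∷ s) (suc p) h = weight≥1 s p h

weight≥2 : (s : BitString m) {p q : Fin m} → p ≢ q →
           lookup s p ≡ true → lookup s q ≡ true → 2 ≤ weight s
weight≥2 (_ ∷ s)     {zero}  {zero}  p≢q _ _ = ⊥-elim (p≢q refl)
weight≥2 (true ∷ s)  {zero}  {suc q} _ _ h = s≤s (weight≥1 s q h)
weight≥2 (true ∷ s)  {suc p} {zero}  _ h _ = s≤s (weight≥1 s p h)
weight≥2 (true ∷ s)  {suc p} {suc q} p≢q hp hq =
  m≤n⇒m≤1+n (weight≥2 s (p≢q ∘ cong suc) hp hq)
weight≥2 (false ∷ s) {suc p} {suc q} p≢q hp hq = weight≥2 s (p≢q ∘ cong suc) hp hq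

-- Both a and b equal their meet, which already has weight 2.
⋀-two-bits⇒≡ : {a b : BitString m} {p q : Fin m} → weight a ≤ 2 → weight b ≤ 2 → p ≢ q →
               lookup (a ⋀ b) p ≡ true → lookup (a ⋀ b) q ≡ true → a ≡ b
⋀-two-bits⇒≡ {a = a} {b} wa wb p≢q hp hq =
  trans (sym (meet≡ (⋀-⊑ˡ a b) wa)) (meet≡ (⋀-⊑ʳ a b) wb)
  where
  meet≡ : {c : BitString _} → a ⋀ b ⊑ c → weight c ≤ 2 → a ⋀ b ≡ c
  meet≡ ⊑c wc = ⊑-antisym-weight ⊑c (≤-trans wc (weight≥2 (a ⋀ b) p≢q hp hq))

⋀-distinct-⊑ : {a b x : BitString m} {k : Fin m} → weight a ≤ 2 → weight b ≤ 2 → a ≢ b →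
               lookup a k ≡ true → lookup b k ≡ true → lookup x k ≡ true → a ⋀ b ⊑ x
⋀-distinct-⊑ {a = a} {b} {x} {k} wa wb a≢b ak bk xk = mk⊑ bit
  where
  bit : ∀ p → lookup (a ⋀ b) p ≡ true → lookup x p ≡ true
  bit p h with p Fin.≟ k
  ... | yes refl = xk
  ... | no p≢k = ⊥-elim (a≢b (⋀-two-bits⇒≡ wa wb p≢k h (⋀-true a b ak bk)))

distinct-pair : {A : Set} {xs : List A} → Unique xs → 2 ≤ length xs →
                ∃₂ λ a b → a ∈ xs × b ∈ xs × a ≢ b
distinct-pair {xs = []}         _ ()
distinct-pair {xs = _ ∷ []}     _ (s≤s ())
distinct-pair {xs = a ∷ b ∷ _} ((a≢b ∷ _) ∷ _) _ = a , b , here refl , there (here refl) , a≢b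

module _ {W : List (BitString m)} (P : Pred (BitString m) ℓ)
         (P-⋀ : ∀ {s t} → P s → P t → P (s ⋀ t)) (P-⋁ : ∀ {s t} → P s → P t → P (s ⋁ t))
         (P-W : All P W) where

  eval-preserves : (f : Formula W) → P (eval f)
  eval-preserves (var w w∈W) = All.lookup P-W w∈W
  eval-preserves (and f g)   = P-⋀ (eval-preserves f) (eval-preserves g)
  eval-preserves (or f g)    = P-⋁ (eval-preserves f) (eval-preserves g)

module _ {W : List (BitString m)} {i : Fin m} where

  private
    bitᵢ? = λ (y : BitString m) → lookup y i ≟ true

  ∈-N⁺ : {w : BitString m} → w ∈ W → lookup w i ≡ true → w ∈ N W i
  ∈-N⁺ = ∈-filter⁺ bitᵢ?

  ∈-N⁻ : {w : BitString m} → w ∈ N W i → w ∈ W × lookup w i ≡ true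
  ∈-N⁻ = ∈-filter⁻ bitᵢ? {xs = W}

  N≡[]⇒eval-bit-false : N W i ≡ [] → (f : Formula W) → lookup (eval f) i ≡ false
  N≡[]⇒eval-bit-false N≡[] = eval-preserves (λ s → lookup s i ≡ false)
    (λ {s} {t} si _  → trans (lookup-⋀ s t i) (cong (_∧ lookup t i) si))
    (λ {s} {t} si ti → trans (lookup-⋁ s t i) (cong₂ _∨_ si ti))
    (All.tabulate bit-false)
    where
    bit-false : {w : BitString m} → w ∈ W → lookup w i ≡ false
    bit-false {w} w∈W with lookup w i in wi
    ... | false = refl
    ... | true with subst (w ∈_) N≡[] (∈-N⁺ w∈W wi)
    ... | ()

  N-lower-bound : {a : BitString m} → All (a ⊑_) (N W i) →
                  (f : Formula W) → lookup (eval f) i ≡ true → a ⊑ eval f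
  N-lower-bound {a} a⊑N = eval-preserves (λ s → lookup s i ≡ true → a ⊑ s) meet join
    (All.tabulate λ w∈W wi → All.lookup a⊑N (∈-N⁺ w∈W wi))
    where
    meet : ∀ {s t} → (lookup s i ≡ true → a ⊑ s) → (lookup t i ≡ true → a ⊑ t) →
           lookup (s ⋀ t) i ≡ true → a ⊑ s ⋀ t
    meet {s} {t} hs ht st =
      ⋀-greatest s t (hs (lookup-⊑ (⋀-⊑ˡ s t) i st)) (ht (lookup-⊑ (⋀-⊑ʳ s t) i st))
    join : ∀ {s t} → (lookup s i ≡ true → a ⊑ s) → (lookup t i ≡ true → a ⊑ t) →
           lookup (s ⋁ t) i ≡ true → a ⊑ s ⋁ t
    join {s} {t} hs ht st with ⋁-true⁻ s t st
    ... | inj₁ si = ⊑-trans (hs si) (⋁-⊑ˡ s t)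
    ... | inj₂ ti = ⊑-trans (ht ti) (⋁-⊑ʳ s t)

  expressible⇒2≤|N| : {x : BitString m} {k : ℕ} → All (λ w → weight w ≡ k) W → weight x ≡ k →
                      x ∉ W → lookup x i ≡ true → Expressible W x → 2 ≤ length (N W i)
  expressible⇒2≤|N| wW wx x∉W xi (f , refl) with N W i in N≡
  ... | [] with trans (sym (N≡[]⇒eval-bit-false N≡ f)) xi
  ... | ()
  expressible⇒2≤|N| wW wx x∉W xi (f , refl) | a ∷ [] = ⊥-elim (x∉W (subst (_∈ W) a≡x a∈W))
    where
    a∈W = proj₁ (∈-N⁻ (subst (a ∈_) (sym N≡) (here refl)))
    a⊑x = N-lower-bound (subst (All (a ⊑_)) (sym N≡) (mk⊑ (λ _ h → h) ∷ [])) f xi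
    a≡x = ⊑-antisym-weight a⊑x (≤-reflexive (trans wx (sym (All.lookup wW a∈W))))
  expressible⇒2≤|N| wW wx x∉W xi (f , refl) | _ ∷ _ ∷ _ = s≤s (s≤s z≤n)

  2≤|N|⇒meet-below : {x : BitString m} → Unique W → All (λ w → weight w ≤ 2) W →
                     2 ≤ length (N W i) → lookup x i ≡ true →
                     Σ (Formula W) λ f → eval f ⊑ x × lookup (eval f) i ≡ true
  2≤|N|⇒meet-below uW wW |N|≥2 xi with distinct-pair (filter⁺ bitᵢ? uW) |N|≥2
  ... | a , b , a∈N , b∈N , a≢b with ∈-N⁻ a∈N | ∈-N⁻ b∈N
  ... | a∈W , ai | b∈W , bi =
    and (var a a∈W) (var b b∈W) ,
    ⋀-distinct-⊑ (All.lookup wW a∈W) (All.lookup wW b∈W) a≢b ai bi xi ,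
    ⋀-true a b ai bi

2≤|N|⇒expressible : {W : List (BitString m)} {x : BitString m} {i j : Fin m} →
                    Unique W → All (λ w → weight w ≤ 2) W → weight x ≤ 2 → i ≢ j →
                    lookup x i ≡ true → lookup x j ≡ true →
                    2 ≤ length (N W i) → 2 ≤ length (N W j) → Expressible W x
2≤|N|⇒expressible uW wW wx i≢j xi xj |Nᵢ|≥2 |Nⱼ|≥2
  with 2≤|N|⇒meet-below uW wW |Nᵢ|≥2 xi | 2≤|N|⇒meet-below uW wW |Nⱼ|≥2 xj
... | f , f⊑x , fi | g , g⊑x , gj =
  or f g , ⊑-antisym-weight (⋁-least (eval f) (eval g) f⊑x g⊑x) (≤-trans wx 2≤|f∨g|)
  where
  2≤|f∨g| : 2 ≤ weight (eval f ⋁ eval g)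
  2≤|f∨g| = weight≥2 (eval f ⋁ eval g) i≢j
    (lookup-⊑ (⋁-⊑ˡ (eval f) (eval g)) _ fi) (lookup-⊑ (⋁-⊑ʳ (eval f) (eval g)) _ gj)

lemma1 : (m : ℕ) → m ≥ 1 → (W : List (BitString m)) → Unique W →
    All (λ y → weight y ≡ 2) W →
    (x : BitString m) → weight x ≡ 2 →
    (i j : Fin m) → i ≢ j → lookup x i ≡ true → lookup x j ≡ true →
    x ∉ W →
    Expressible W x ⇔ (length (N W i) ≥ 2 × length (N W j) ≥ 2)
lemma1 _ _ W uW wW x wx i j i≢j xi xj x∉W = mk⇔
  (λ e → expressible⇒2≤|N| wW wx x∉W xi e , expressible⇒2≤|N| wW wx x∉W xj e)
  (λ (|Nᵢ|≥2 , |Nⱼ|≥2) →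
     2≤|N|⇒expressible uW (All.map ≤-reflexive wW) (≤-reflexive wx) i≢j xi xj |Nᵢ|≥2 |Nⱼ|≥2)
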